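{- Let $n\ge 2$ and for $0\le i\le n-1$ let $s_{n,i}$ be the number of simple $n$-braids of length $i$. The number of edges of the simple graph $\Gamma_{\mathcal{SB}_n}$ is $$e(\Gamma_{\mathcal{SB}_n})=(n-1)s_{n,0}+(n-2)s_{n,1}+\cdots+1\cdot s_{n,n-2}=\sum_{i=0}^{n-1}(n-1-i)s_{n,i}.$$
   Context: The braid group $B_n$ has generators $x_1,\dots,x_{n-1}$ and relations $x_ix_j=x_jx_i$ for $|i-j|\ge 2$ and $x_ix_{i+1}x_i=x_{i+1}x_ix_{i+1}$ for $1\le i\le n-2$; positive braids are those represented by positive words, with well-defined length. A simple braid is a positive braid that can be represented by a positive word in which each letter $x_i$ occurs at most once; $\mathcal{SB}_n$ is the set of simple $n$-braids. The simple graph $\Gamma_{\mathcal{SB}_n}$ is the (simple, undirected) subgraph of the Cayley graph of $B_n$ with respect to $x_1,\dots,x_{n-1}$ whose vertex set is $\mathcal{SB}_n$ and in which two simple braids $\beta,\beta'$ are joined by an edge if and only if $\beta'=\beta x_i$ or $\beta=\beta' x_i$ for some $i\in\{1,\dots,n-1\}$. -}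

module Defs where

open import Data.Nat using (ℕ; zero; suc; _+_; _*_; _∸_; _<_; _≤_; pred)
open import Data.Nat.Properties using (_≟_)
open import Data.Fin using (Fin; toℕ)
open import Data.Bool using (Bool; true; false; not)
open import Data.Product using (_×_; _,_; ∃-syntax; Σ-syntax)
open import Data.Sum using (_⊎_)
open import Data.List using (List; []; _∷_; _++_; map; length; filter; lookup; upTo)
open import Data.Nat.ListAction using (sum)
open import Data.List.Relation.Unary.Unique.Propositional using (Unique)
open import Data.List.Membership.Propositional using (_∈_)
open import Relation.Binary.PropositionalEquality using (_≡_)
open import Relation.Nullary using (¬_)
open import Function.Bundles using (_⇔_)

-- Generators x_1 .. x_{n-1} of B_n are indexed by Fin (pred n)
-- (Fin index k stands for x_{k+1}).
Gen : ℕ → Set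
Gen n = Fin (pred n)

-- A letter of a group word: a generator together with a sign
-- (true = x_i, false = x_i⁻¹).
Letter : ℕ → Set
Letter n = Gen n × Bool

Word : ℕ → Set
Word n = List (Letter n)

PosWord : ℕ → Set
PosWord n = List (Gen n)

embed : (n : ℕ) → PosWord n → Word n
embed n = map (λ i → (i , true))

-- Equality in the braid group B_n: the congruence on group words generated
-- by free cancellation and the braid relations (the group presentation).
syntax BraidEq n u v = u ≈[ n ] v

data BraidEq (n : ℕ) : Word n → Word n → Set where
  ≈-refl  : ∀ {u} → u ≈[ n ] u
  ≈-sym   : ∀ {u v} → u ≈[ n ] v → v ≈[ n ] u
  ≈-trans : ∀ {u v w} → u ≈[ n ] v → v ≈[ n ] w → u ≈[ n ] w
  ≈-cong  : ∀ {u v} (a b : Word n) → u ≈[ n ] v → (a ++ u ++ b) ≈[ n ] (a ++ v ++ b)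
  cancel  : ∀ (i : Gen n) (s : Bool) → ((i , s) ∷ (i , not s) ∷ []) ≈[ n ] []
  comm    : ∀ (i j : Gen n) → suc (toℕ i) < toℕ j →
            ((i , true) ∷ (j , true) ∷ []) ≈[ n ] ((j , true) ∷ (i , true) ∷ [])
  braid   : ∀ (i j : Gen n) → toℕ j ≡ suc (toℕ i) →
            ((i , true) ∷ (j , true) ∷ (i , true) ∷ [])
              ≈[ n ] ((j , true) ∷ (i , true) ∷ (j , true) ∷ [])

SimpleWord : (n : ℕ) → PosWord n → Set
SimpleWord n w = Unique w

IsSimpleBraid : (n : ℕ) → Word n → Set
IsSimpleBraid n β = ∃[ w ] (SimpleWord n w × (β ≈[ n ] embed n w))

IsSimpleRepSystem : (n : ℕ) → List (PosWord n) → Set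
IsSimpleRepSystem n L =
  ((a : Fin (length L)) → SimpleWord n (lookup L a)) ×
  ((a b : Fin (length L)) → embed n (lookup L a) ≈[ n ] embed n (lookup L b) → a ≡ b) ×
  ((β : Word n) → IsSimpleBraid n β → ∃[ a ] (β ≈[ n ] embed n (lookup L a)))

Adjacent : (n : ℕ) (L : List (PosWord n)) → Fin (length L) → Fin (length L) → Set
Adjacent n L a b =
  ∃[ i ] ((embed n (lookup L a ++ i ∷ []) ≈[ n ] embed n (lookup L b))
         ⊎ (embed n (lookup L b ++ i ∷ []) ≈[ n ] embed n (lookup L a)))

-- E lists every edge {a,b} of Γ_{SB_n} exactly once (as the ordered pair with a < b).
IsEdgeEnumeration : (n : ℕ) (L : List (PosWord n)) → List (Fin (length L) × Fin (length L)) → Set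
IsEdgeEnumeration n L E =
  Unique E ×
  ((a b : Fin (length L)) → ((a , b) ∈ E) ⇔ ((toℕ a < toℕ b) × Adjacent n L a b))

sCount : (n : ℕ) → List (PosWord n) → ℕ → ℕ
sCount n L i = length (filter (λ w → length w ≟ i) L)

edgeFormula : (n : ℕ) → List (PosWord n) → ℕ
edgeFormula n L = sum (map (λ i → (n ∸ 1 ∸ i) * sCount n L i) (upTo n))

module Submission where

-- Fix a system L of simple words representing each simple braid once.
-- Call a pair (a , j) a free move if the letter x_j does not occur in the
-- representative w_a.  Then w_a x_j is again a simple word, so it represents
-- some w_r, and {a , r} is an edge.  Conversely every edge {a , b} with
-- w_a x_i = w_b arises this way: x_i cannot already occur in w_a, because the
-- permutation of a braid determines the letters of any simple word for it
-- and the exponent sum determines its length.  Distinct free moves give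
-- distinct edges: the letter is recovered from w_a x_j by right
-- cancellation in the symmetric group, and the direction of an edge is
-- fixed by the lengths of its ends.  Hence the edges are in bijection with
-- the free moves, of which there are Σ_a ((n-1) - |w_a|) =
-- Σ_i (n-1-i) s_{n,i}.

open import Defs
open import Data.Nat using (ℕ; zero; suc; pred; _+_; _*_; _∸_; _≤_; _<_; z≤n; s≤s; _<?_)
open import Data.Nat.Properties
  using (_≟_; ≤-refl; ≤-trans; ≤-reflexive; ≤-antisym; n≮n; <-asym; <-cmp; +-comm; +-suc; *-zeroʳ; *-suc; +-identityʳ; m+n∸m≡n; +-commutativeSemigroup)
open import Algebra.Properties.CommutativeSemigroup +-commutativeSemigroup using (interchange)
open import Data.Nat.ListAction using (sum)
open import Data.Integer as ℤ using (ℤ; 0ℤ; 1ℤ; -1ℤ)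
import Data.Integer.Properties as ℤ
open import Data.Fin using (Fin; toℕ) renaming (_≟_ to _≟ᶠ_)
open import Data.Fin.Properties using (toℕ-injective)
open import Data.Bool using (Bool; true; false)
open import Data.Product using (_×_; _,_; proj₁; proj₂; Σ; ∃-syntax)
open import Data.Sum using (_⊎_; inj₁; inj₂)
open import Data.Empty using (⊥; ⊥-elim)
open import Data.List
  using (List; []; _∷_; _++_; map; length; filter; lookup; reverse; allFin; upTo; tabulate; cartesianProduct)
open import Data.List.Properties
  using (length-++; length-map; length-tabulate; unfold-reverse; filter-notAll; filter-accept; filter-reject; filter-++; map-cong; map-tabulate; tabulate-lookup)
open import Data.List.Relation.Unary.All as All using (All; []; _∷_)
import Data.List.Relation.Unary.All.Properties as All
open import Data.List.Relation.Unary.Any as Any using (here; there)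
open import Data.List.Relation.Unary.Any.Properties using (reverse⁻; lookup-index)
open import Data.List.Relation.Unary.AllPairs using ([]; _∷_)
open import Data.List.Relation.Unary.Unique.Propositional using (Unique)
import Data.List.Relation.Unary.Unique.Propositional.Properties as Unique
open import Data.List.Membership.Propositional using (_∈_; _∉_)
open import Data.List.Membership.Propositional.Properties
  using (∈-++⁻; ∈-filter⁺; ∈-filter⁻; ∈-map⁺; ∈-map⁻; ∈-allFin; ∈-cartesianProduct⁺; ∈-upTo⁺)
import Data.List.Membership.DecPropositional as DecMembership
open import Relation.Binary.Definitions using (DecidableEquality; tri<; tri≈; tri>)
open import Relation.Binary.PropositionalEquality
open import Relation.Nullary using (¬_; Dec; yes; no; ¬?)
open import Relation.Unary using (Pred; Decidable)
open import Relation.Unary.Properties using (∁?)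
open import Function using (_∘_)
open import Level using (0ℓ)
open import Function.Bundles using (mk⇔)

open ≡-Reasoning

-- Adjacent transpositions of ℕ

-- τ t exchanges t and t+1 and fixes every other number; the generator
-- x_{t+1} of B_n acts on ℕ through τ t.
τ : ℕ → ℕ → ℕ
τ zero    zero          = 1
τ zero    (suc zero)    = 0
τ zero    (suc (suc x)) = suc (suc x)
τ (suc t) zero          = zero
τ (suc t) (suc x)       = suc (τ t x)

τ-involutive : ∀ t x → τ t (τ t x) ≡ x
τ-involutive zero    zero          = refl
τ-involutive zero    (suc zero)    = refl
τ-involutive zero    (suc (suc x)) = refl
τ-involutive (suc t) zero          = refl
τ-involutive (suc t) (suc x)       = cong suc (τ-involutive t x)

τ-braid : ∀ t x → τ t (τ (suc t) (τ t x)) ≡ τ (suc t) (τ t (τ (suc t) x))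
τ-braid zero    zero                = refl
τ-braid zero    (suc zero)          = refl
τ-braid zero    (suc (suc zero))    = refl
τ-braid zero    (suc (suc (suc x))) = refl
τ-braid (suc t) zero                = refl
τ-braid (suc t) (suc x)             = cong suc (τ-braid t x)

τ-far-commute : ∀ t u → suc t < u → ∀ x → τ t (τ u x) ≡ τ u (τ t x)
τ-far-commute zero    (suc zero)          (s≤s ())  x
τ-far-commute zero    (suc (suc u))       _         zero                = refl
τ-far-commute zero    (suc (suc u))       _         (suc zero)          = refl
τ-far-commute zero    (suc (suc zero))    _         (suc (suc zero))    = refl
τ-far-commute zero    (suc (suc zero))    _         (suc (suc (suc x))) = refl
τ-far-commute zero    (suc (suc (suc u))) _         (suc (suc x))       = refl
τ-far-commute (suc t) (suc u)             (s≤s t<u) zero                = refl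
τ-far-commute (suc t) (suc u)             (s≤s t<u) (suc x)             = cong suc (τ-far-commute t u t<u x)

τ-at : ∀ t → τ t t ≡ suc t
τ-at zero    = refl
τ-at (suc t) = cong suc (τ-at t)

-- Only τ x sends x to x+1; used to read off the last letter of a word.
τ-raises-only-itself : ∀ t x → τ t x ≡ suc x → t ≡ x
τ-raises-only-itself zero    zero          _ = refl
τ-raises-only-itself zero    (suc zero)    ()
τ-raises-only-itself zero    (suc (suc x)) ()
τ-raises-only-itself (suc t) zero          ()
τ-raises-only-itself (suc t) (suc x)       e = cong suc (τ-raises-only-itself t x (cong pred e))

StableBelow : (ℕ → ℕ) → ℕ → Set
StableBelow f j = ∀ x → x ≤ j → f x ≤ j

τ-stable : ∀ t j → t ≢ j → StableBelow (τ t) j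
τ-stable zero    zero    t≢j = ⊥-elim (t≢j refl)
τ-stable zero    (suc j) _   zero          _ = s≤s z≤n
τ-stable zero    (suc j) _   (suc zero)    _ = z≤n
τ-stable zero    (suc j) _   (suc (suc x)) x≤j = x≤j
τ-stable (suc t) zero    _   zero          _ = z≤n
τ-stable (suc t) (suc j) _   zero          _ = z≤n
τ-stable (suc t) (suc j) t≢j (suc x) (s≤s x≤j) = s≤s (τ-stable t j (t≢j ∘ cong suc) x x≤j)

act : {A : Set} → (A → ℕ → ℕ) → List A → ℕ → ℕ
act f []      x = x
act f (a ∷ w) x = act f w (f a x)

module _ {A : Set} (f : A → ℕ → ℕ) where

  act-++ : ∀ u v x → act f (u ++ v) x ≡ act f v (act f u x)
  act-++ []      v x = refl
  act-++ (a ∷ u) v x = act-++ u v (f a x)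

  act-map : ∀ {B : Set} (g : B → A) w x → act f (map g w) x ≡ act (f ∘ g) w x
  act-map g []      x = refl
  act-map g (b ∷ w) x = act-map g w (f (g b) x)

  act-snoc : ∀ w a x → act f (w ++ a ∷ []) x ≡ f a (act f w x)
  act-snoc w a x = act-++ w (a ∷ []) x

  module _ (involutive : ∀ a x → f a (f a x) ≡ x) where

    act-reverseʳ : ∀ w x → act f w (act f (reverse w) x) ≡ x
    act-reverseʳ []      x = refl
    act-reverseʳ (a ∷ w) x = begin
      act f w (f a (act f (reverse (a ∷ w)) x))
        ≡⟨ cong (λ v → act f w (f a (act f v x))) (unfold-reverse a w) ⟩
      act f w (f a (act f (reverse w ++ a ∷ []) x))
        ≡⟨ cong (act f w ∘ f a) (act-snoc (reverse w) a x) ⟩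
      act f w (f a (f a (act f (reverse w) x)))
        ≡⟨ cong (act f w) (involutive a _) ⟩
      act f w (act f (reverse w) x)
        ≡⟨ act-reverseʳ w x ⟩
      x ∎

    act-reverseˡ : ∀ w x → act f (reverse w) (act f w x) ≡ x
    act-reverseˡ []      x = refl
    act-reverseˡ (a ∷ w) x = begin
      act f (reverse (a ∷ w)) (act f w (f a x))
        ≡⟨ cong (λ v → act f v (act f w (f a x))) (unfold-reverse a w) ⟩
      act f (reverse w ++ a ∷ []) (act f w (f a x))
        ≡⟨ act-snoc (reverse w) a _ ⟩
      f a (act f (reverse w) (act f w (f a x)))
        ≡⟨ cong (f a) (act-reverseˡ w (f a x)) ⟩
      f a (f a x)
        ≡⟨ involutive a x ⟩
      x ∎

-- The permutation of a positive word, and what it knows about simple words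

ρ : ∀ {k} → List (Fin k) → ℕ → ℕ
ρ = act (τ ∘ toℕ)

unique-split : ∀ {A : Set} {w : List A} {x} → Unique w → x ∈ w →
               ∃[ u ] ∃[ v ] (w ≡ u ++ x ∷ v × x ∉ u × x ∉ v)
unique-split (x∉v ∷ _) (here refl) = [] , _ , refl , (λ ()) , λ x∈v → All.lookup x∉v x∈v refl
unique-split {w = y ∷ _} (y∉w ∷ uw) (there x∈w) with unique-split uw x∈w
... | u , v , refl , x∉u , x∉v = y ∷ u , v , refl , x∉y∷u , x∉v
  where
  x∉y∷u : _ ∉ y ∷ u
  x∉y∷u (here x≡y)  = All.lookup y∉w x∈w (sym x≡y)
  x∉y∷u (there x∈u) = x∉u x∈u

module _ {k : ℕ} where

  open DecMembership (_≟ᶠ_ {k}) using (_∈?_)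

  ρ-++ : ∀ (u v : List (Fin k)) x → ρ (u ++ v) x ≡ ρ v (ρ u x)
  ρ-++ = act-++ (τ ∘ toℕ)

  ρ-reverseʳ : ∀ (w : List (Fin k)) x → ρ w (ρ (reverse w) x) ≡ x
  ρ-reverseʳ = act-reverseʳ (τ ∘ toℕ) (τ-involutive ∘ toℕ)

  ρ-reverseˡ : ∀ (w : List (Fin k)) x → ρ (reverse w) (ρ w x) ≡ x
  ρ-reverseˡ = act-reverseˡ (τ ∘ toℕ) (τ-involutive ∘ toℕ)

  ∉⇒stable : ∀ (w : List (Fin k)) {j} → j ∉ w → StableBelow (ρ w) (toℕ j)
  ∉⇒stable []      _   x x≤j = x≤j
  ∉⇒stable (i ∷ w) j∉w x x≤j =
    ∉⇒stable w (j∉w ∘ there) (τ (toℕ i) x)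
      (τ-stable (toℕ i) _ (λ e → j∉w (here (toℕ-injective (sym e)))) x x≤j)

  -- A single occurrence of j between two j-free words moves {0, …, toℕ j}:
  -- the preimage of j under ρ u stays below j, but is sent to the image
  -- of j+1 under ρ v, which lies above j.
  inserted-letter-unstable : ∀ (u v : List (Fin k)) {j} → j ∉ u → j ∉ v →
                             ¬ StableBelow (ρ (u ++ j ∷ v)) (toℕ j)
  inserted-letter-unstable u v {j} j∉u j∉v stable =
    n≮n (toℕ j) (subst (_≤ toℕ j) (ρ-reverseˡ v (suc (toℕ j))) pulled-back)
    where
    x : ℕ
    x = ρ (reverse u) (toℕ j)

    x≤j : x ≤ toℕ j
    x≤j = ∉⇒stable (reverse u) (j∉u ∘ reverse⁻) (toℕ j) ≤-refl

    image : ρ (u ++ j ∷ v) x ≡ ρ v (suc (toℕ j))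
    image = begin
      ρ (u ++ j ∷ v) x         ≡⟨ ρ-++ u (j ∷ v) x ⟩
      ρ v (τ (toℕ j) (ρ u x))  ≡⟨ cong (ρ v ∘ τ (toℕ j)) (ρ-reverseʳ u (toℕ j)) ⟩
      ρ v (τ (toℕ j) (toℕ j))  ≡⟨ cong (ρ v) (τ-at (toℕ j)) ⟩
      ρ v (suc (toℕ j))        ∎

    pulled-back : ρ (reverse v) (ρ v (suc (toℕ j))) ≤ toℕ j
    pulled-back = ∉⇒stable (reverse v) (j∉v ∘ reverse⁻) _
                    (subst (_≤ toℕ j) image (stable x x≤j))

  ∈⇒unstable : ∀ {w : List (Fin k)} {j} → Unique w → j ∈ w → ¬ StableBelow (ρ w) (toℕ j)
  ∈⇒unstable uw j∈w with unique-split uw j∈w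
  ... | u , v , refl , j∉u , j∉v = inserted-letter-unstable u v j∉u j∉v

  -- Every letter of a simple word w' occurs in any word with the same
  -- permutation: a missing letter would keep its initial segment stable.
  letters-determined : ∀ {w' w : List (Fin k)} → Unique w' → (∀ x → ρ w' x ≡ ρ w x) →
                       ∀ {j} → j ∈ w' → j ∈ w
  letters-determined {w' = w'} {w} uw' same {j} j∈w' with j ∈? w
  ... | yes j∈w = j∈w
  ... | no  j∉w = ⊥-elim (∈⇒unstable uw' j∈w' λ x x≤j →
                    subst (_≤ toℕ j) (sym (same x)) (∉⇒stable w j∉w x x≤j))

  -- Right cancellation of a single letter, read off at the preimage of j.
  last-letter-determined : ∀ (w : List (Fin k)) {j j'} →
                           (∀ x → ρ (w ++ j ∷ []) x ≡ ρ (w ++ j' ∷ []) x) → j ≡ j'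
  last-letter-determined w {j} {j'} same =
    sym (toℕ-injective (τ-raises-only-itself (toℕ j') (toℕ j) raised))
    where
    at-preimage : ∀ i → ρ (w ++ i ∷ []) (ρ (reverse w) (toℕ j)) ≡ τ (toℕ i) (toℕ j)
    at-preimage i = trans (ρ-++ w (i ∷ []) _) (cong (τ (toℕ i)) (ρ-reverseʳ w (toℕ j)))

    raised : τ (toℕ j') (toℕ j) ≡ suc (toℕ j)
    raised = begin
      τ (toℕ j') (toℕ j)                           ≡⟨ sym (at-preimage j') ⟩
      ρ (w ++ j' ∷ []) (ρ (reverse w) (toℕ j))     ≡⟨ sym (same _) ⟩
      ρ (w ++ j ∷ []) (ρ (reverse w) (toℕ j))      ≡⟨ at-preimage j ⟩
      τ (toℕ j) (toℕ j)                            ≡⟨ τ-at (toℕ j) ⟩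
      suc (toℕ j)                                  ∎

module _ {A : Set} (_≟ₐ_ : DecidableEquality A) where

  pigeonhole : ∀ {xs ys : List A} → Unique xs → (∀ {x} → x ∈ xs → x ∈ ys) → length xs ≤ length ys
  pigeonhole {[]}     _          _  = z≤n
  pigeonhole {x ∷ xs} {ys} (x∉xs ∷ uxs) xs⊆ys =
    ≤-trans (s≤s (pigeonhole uxs xs⊆others))
            (filter-notAll other? ys (Any.map (λ x≡y x≢y → x≢y x≡y) (xs⊆ys (here refl))))
    where
    other? : Decidable (x ≢_)
    other? y = ¬? (x ≟ₐ y)

    xs⊆others : ∀ {z} → z ∈ xs → z ∈ filter other? ys
    xs⊆others z∈xs = ∈-filter⁺ other? (xs⊆ys (there z∈xs)) (All.lookup x∉xs z∈xs)

length-filter-∁ : ∀ {A : Set} {P : Pred A 0ℓ} (P? : Decidable P) xs →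
                  length (filter P? xs) + length (filter (∁? P?) xs) ≡ length xs
length-filter-∁ P? []       = refl
length-filter-∁ P? (x ∷ xs) with P? x
... | yes _ = cong suc (length-filter-∁ P? xs)
... | no  _ = trans (+-suc _ _) (cong suc (length-filter-∁ P? xs))

missing : ∀ {k} → List (Fin k) → List (Fin k)
missing {k} w = filter (λ i → ¬? (i ∈? w)) (allFin k)
  where open DecMembership (_≟ᶠ_ {k}) using (_∈?_)

missing-length : ∀ {k} {w : List (Fin k)} → Unique w → length (missing w) ≡ k ∸ length w
missing-length {k} {w} uw = begin
  length (missing w)                              ≡⟨ sym (m+n∸m≡n (length w) _) ⟩
  length w + length (missing w) ∸ length w        ≡⟨ cong (λ u → u + length (missing w) ∸ length w) (sym used-length) ⟩
  length used + length (missing w) ∸ length w     ≡⟨ cong (_∸ length w) (length-filter-∁ (_∈? w) (allFin k)) ⟩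
  length (allFin k) ∸ length w                    ≡⟨ cong (_∸ length w) (length-tabulate (λ i → i)) ⟩
  k ∸ length w                                    ∎
  where
  open DecMembership (_≟ᶠ_ {k}) using (_∈?_)

  used : List (Fin k)
  used = filter (_∈? w) (allFin k)

  -- used and w are duplicate-free lists with the same elements
  used-length : length used ≡ length w
  used-length = ≤-antisym
    (pigeonhole _≟ᶠ_ (Unique.filter⁺ (_∈? w) (Unique.allFin⁺ k)) (proj₂ ∘ ∈-filter⁻ (_∈? w) {xs = allFin k}))
    (pigeonhole _≟ᶠ_ uw (∈-filter⁺ (_∈? w) (∈-allFin _)))

length-filter-map : ∀ {A B : Set} {P : Pred A 0ℓ} (P? : Decidable P) (h : B → A) ys →
                    length (filter P? (map h ys)) ≡ length (filter (P? ∘ h) ys)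
length-filter-map P? h []       = refl
length-filter-map P? h (y ∷ ys) with P? (h y)
... | yes _ = cong suc (length-filter-map P? h ys)
... | no  _ = length-filter-map P? h ys

length-filter-× : ∀ {A B : Set} {P : Pred (A × B) 0ℓ} (P? : Decidable P) xs ys →
                  length (filter P? (cartesianProduct xs ys))
                    ≡ sum (map (λ x → length (filter (λ y → P? (x , y)) ys)) xs)
length-filter-× P? []       ys = refl
length-filter-× P? (x ∷ xs) ys = begin
  length (filter P? (map (x ,_) ys ++ cartesianProduct xs ys))
    ≡⟨ cong length (filter-++ P? (map (x ,_) ys) _) ⟩
  length (filter P? (map (x ,_) ys) ++ filter P? (cartesianProduct xs ys))
    ≡⟨ length-++ (filter P? (map (x ,_) ys)) ⟩
  length (filter P? (map (x ,_) ys)) + length (filter P? (cartesianProduct xs ys))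
    ≡⟨ cong₂ _+_ (length-filter-map P? (x ,_) ys) (length-filter-× P? xs ys) ⟩
  sum (map (λ x → length (filter (λ y → P? (x , y)) ys)) (x ∷ xs)) ∎

unique-map-local : ∀ {A B : Set} (f : A → B) {xs} → Unique xs →
                   (∀ {x y} → x ∈ xs → y ∈ xs → f x ≡ f y → x ≡ y) → Unique (map f xs)
unique-map-local f []            _   = []
unique-map-local f (x∉xs ∷ uxs) inj =
  All.map⁺ (All.tabulate λ y∈xs fx≡fy → All.lookup x∉xs y∈xs (inj (here refl) (there y∈xs) fx≡fy))
  ∷ unique-map-local f uxs (λ x∈ y∈ → inj (there x∈) (there y∈))

sum-map-+ : ∀ {A : Set} (h₁ h₂ : A → ℕ) xs →
            sum (map (λ x → h₁ x + h₂ x) xs) ≡ sum (map h₁ xs) + sum (map h₂ xs)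
sum-map-+ h₁ h₂ []       = refl
sum-map-+ h₁ h₂ (x ∷ xs) = begin
  h₁ x + h₂ x + sum (map (λ x → h₁ x + h₂ x) xs)        ≡⟨ cong (h₁ x + h₂ x +_) (sum-map-+ h₁ h₂ xs) ⟩
  h₁ x + h₂ x + (sum (map h₁ xs) + sum (map h₂ xs))     ≡⟨ interchange (h₁ x) (h₂ x) _ _ ⟩
  h₁ x + sum (map h₁ xs) + (h₂ x + sum (map h₂ xs))     ∎

sum-map-zero : ∀ {A : Set} (h : A → ℕ) {xs} → All (λ x → h x ≡ 0) xs → sum (map h xs) ≡ 0
sum-map-zero h []           = refl
sum-map-zero h (hx≡0 ∷ all) = cong₂ _+_ hx≡0 (sum-map-zero h all)

module Fibres {A : Set} (f : A → ℕ) (g : ℕ → ℕ) where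

  fibre : List A → ℕ → ℕ
  fibre L i = length (filter (λ a → f a ≟ i) L)

  pointMass : ℕ → ℕ → ℕ
  pointMass k i with k ≟ i
  ... | yes _ = g i
  ... | no  _ = 0

  pointMass-at : ∀ k → pointMass k k ≡ g k
  pointMass-at k with k ≟ k
  ... | yes _   = refl
  ... | no  k≢k = ⊥-elim (k≢k refl)

  pointMass-off : ∀ {k i} → k ≢ i → pointMass k i ≡ 0
  pointMass-off {k} {i} k≢i with k ≟ i
  ... | yes k≡i = ⊥-elim (k≢i k≡i)
  ... | no  _   = refl

  sum-pointMass : ∀ {k is} → Unique is → k ∈ is → sum (map (pointMass k) is) ≡ g k
  sum-pointMass {k} {_ ∷ rest} (k∉rest ∷ _) (here refl) = begin
    pointMass k k + sum (map (pointMass k) rest) ≡⟨ cong₂ _+_ (pointMass-at k) (sum-map-zero _ (All.map pointMass-off k∉rest)) ⟩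
    g k + 0                                   ≡⟨ +-identityʳ (g k) ⟩
    g k                                       ∎
  sum-pointMass (x∉is ∷ uis) (there k∈is) =
    cong₂ _+_ (pointMass-off λ k≡x → All.lookup x∉is k∈is (sym k≡x)) (sum-pointMass uis k∈is)

  fibre-cons : ∀ a L i → g i * fibre (a ∷ L) i ≡ pointMass (f a) i + g i * fibre L i
  fibre-cons a L i = by-cases (f a ≟ i)
    where
    in-fibre? : Decidable (λ b → f b ≡ i)
    in-fibre? b = f b ≟ i

    by-cases : Dec (f a ≡ i) → g i * fibre (a ∷ L) i ≡ pointMass (f a) i + g i * fibre L i
    by-cases (yes refl) = begin
      g i * fibre (a ∷ L) i          ≡⟨ cong (λ l → g i * length l) (filter-accept in-fibre? refl) ⟩
      g i * suc (fibre L i)          ≡⟨ *-suc (g i) (fibre L i) ⟩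
      g i + g i * fibre L i          ≡⟨ cong (_+ g i * fibre L i) (sym (pointMass-at i)) ⟩
      pointMass i i + g i * fibre L i ∎
    by-cases (no fa≢i) = begin
      g i * fibre (a ∷ L) i          ≡⟨ cong (λ l → g i * length l) (filter-reject in-fibre? fa≢i) ⟩
      g i * fibre L i                ≡⟨ cong (_+ g i * fibre L i) (sym (pointMass-off fa≢i)) ⟩
      pointMass (f a) i + g i * fibre L i ∎

  sum-by-fibres : ∀ (L : List A) {is} → Unique is → All (λ a → f a ∈ is) L →
                  sum (map (g ∘ f) L) ≡ sum (map (λ i → g i * fibre L i) is)
  sum-by-fibres [] {is} _ [] = sym (sum-map-zero _ (All.tabulate {xs = is} λ {i} _ → *-zeroʳ (g i)))
  sum-by-fibres (a ∷ L) {is} uis (fa∈is ∷ L⊆is) = begin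
    g (f a) + sum (map (g ∘ f) L)
      ≡⟨ cong₂ _+_ (sym (sum-pointMass uis fa∈is)) (sum-by-fibres L uis L⊆is) ⟩
    sum (map (pointMass (f a)) is) + sum (map (λ i → g i * fibre L i) is)
      ≡⟨ sym (sum-map-+ (pointMass (f a)) (λ i → g i * fibre L i) is) ⟩
    sum (map (λ i → pointMass (f a) i + g i * fibre L i) is)
      ≡⟨ cong sum (map-cong (λ i → sym (fibre-cons a L i)) is) ⟩
    sum (map (λ i → g i * fibre (a ∷ L) i) is) ∎

module _ {N : ℕ} where

  sortPair : Fin N → Fin N → Fin N × Fin N
  sortPair a b with toℕ a <? toℕ b
  ... | yes _ = a , b
  ... | no  _ = b , a

  sortPair-< : ∀ {a b} → toℕ a < toℕ b → sortPair a b ≡ (a , b)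
  sortPair-< {a} {b} a<b with toℕ a <? toℕ b
  ... | yes _   = refl
  ... | no  a≮b = ⊥-elim (a≮b a<b)

  sortPair-> : ∀ {a b} → toℕ b < toℕ a → sortPair a b ≡ (b , a)
  sortPair-> {a} {b} b<a with toℕ a <? toℕ b
  ... | yes a<b = ⊥-elim (<-asym a<b b<a)
  ... | no  _   = refl

  sortPair-cases : ∀ a b → a ≢ b →
                   (toℕ a < toℕ b × sortPair a b ≡ (a , b)) ⊎ (toℕ b < toℕ a × sortPair a b ≡ (b , a))
  sortPair-cases a b a≢b with <-cmp (toℕ a) (toℕ b)
  ... | tri< a<b _ _ = inj₁ (a<b , sortPair-< a<b)
  ... | tri≈ _ a≡b _ = ⊥-elim (a≢b (toℕ-injective a≡b))
  ... | tri> _ _ b<a = inj₂ (b<a , sortPair-> b<a)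

  sortPair-injective : ∀ {a b c d} → sortPair a b ≡ sortPair c d → (a ≡ c × b ≡ d) ⊎ (a ≡ d × b ≡ c)
  sortPair-injective {a} {b} {c} {d} eq with toℕ a <? toℕ b | toℕ c <? toℕ d
  sortPair-injective refl | yes _ | yes _ = inj₁ (refl , refl)
  sortPair-injective refl | yes _ | no  _ = inj₂ (refl , refl)
  sortPair-injective refl | no  _ | yes _ = inj₂ (refl , refl)
  sortPair-injective refl | no  _ | no  _ = inj₁ (refl , refl)

-- Braid invariants

sign : Bool → ℤ
sign true  = 1ℤ
sign false = -1ℤ

module BraidInvariants (n : ℕ) where

  perm : Word n → ℕ → ℕ
  perm = act (τ ∘ toℕ ∘ proj₁)

  perm-sandwich : ∀ a u b x → perm (a ++ u ++ b) x ≡ perm b (perm u (perm a x))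
  perm-sandwich a u b x = trans (act-++ _ a (u ++ b) x) (act-++ _ u b _)

  perm-resp : ∀ {u v} → u ≈[ n ] v → ∀ x → perm u x ≡ perm v x
  perm-resp ≈-refl        x = refl
  perm-resp (≈-sym p)     x = sym (perm-resp p x)
  perm-resp (≈-trans p q) x = trans (perm-resp p x) (perm-resp q x)
  perm-resp (≈-cong {u} {v} a b p) x = begin
    perm (a ++ u ++ b) x        ≡⟨ perm-sandwich a u b x ⟩
    perm b (perm u (perm a x))  ≡⟨ cong (perm b) (perm-resp p (perm a x)) ⟩
    perm b (perm v (perm a x))  ≡⟨ sym (perm-sandwich a v b x) ⟩
    perm (a ++ v ++ b) x        ∎
  perm-resp (cancel i _)         x = τ-involutive (toℕ i) x
  perm-resp (comm i j i+1<j)     x = sym (τ-far-commute (toℕ i) (toℕ j) i+1<j x)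
  perm-resp (braid i j j≡i+1)    x rewrite j≡i+1 = τ-braid (toℕ i) x

  ρ-resp : ∀ {u v : PosWord n} → embed n u ≈[ n ] embed n v → ∀ x → ρ u x ≡ ρ v x
  ρ-resp {u} {v} p x = begin
    ρ u x                ≡⟨ sym (act-map _ _ u x) ⟩
    perm (embed n u) x   ≡⟨ perm-resp p x ⟩
    perm (embed n v) x   ≡⟨ act-map _ _ v x ⟩
    ρ v x                ∎

  expSum : Word n → ℤ
  expSum []            = 0ℤ
  expSum ((_ , s) ∷ w) = sign s ℤ.+ expSum w

  expSum-++ : ∀ u v → expSum (u ++ v) ≡ expSum u ℤ.+ expSum v
  expSum-++ []            v = sym (ℤ.+-identityˡ (expSum v))
  expSum-++ ((_ , s) ∷ u) v = trans (cong (λ e → sign s ℤ.+ e) (expSum-++ u v)) (sym (ℤ.+-assoc (sign s) (expSum u) (expSum v)))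

  expSum-sandwich : ∀ a u b → expSum (a ++ u ++ b) ≡ expSum a ℤ.+ (expSum u ℤ.+ expSum b)
  expSum-sandwich a u b = trans (expSum-++ a (u ++ b)) (cong (λ e → expSum a ℤ.+ e) (expSum-++ u b))

  expSum-resp : ∀ {u v} → u ≈[ n ] v → expSum u ≡ expSum v
  expSum-resp ≈-refl        = refl
  expSum-resp (≈-sym p)     = sym (expSum-resp p)
  expSum-resp (≈-trans p q) = trans (expSum-resp p) (expSum-resp q)
  expSum-resp (≈-cong {u} {v} a b p) = begin
    expSum (a ++ u ++ b)                       ≡⟨ expSum-sandwich a u b ⟩
    expSum a ℤ.+ (expSum u ℤ.+ expSum b)       ≡⟨ cong (λ e → expSum a ℤ.+ (e ℤ.+ expSum b)) (expSum-resp p) ⟩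
    expSum a ℤ.+ (expSum v ℤ.+ expSum b)       ≡⟨ sym (expSum-sandwich a v b) ⟩
    expSum (a ++ v ++ b)                       ∎
  expSum-resp (cancel i true)  = refl
  expSum-resp (cancel i false) = refl
  expSum-resp (comm i j _)     = refl
  expSum-resp (braid i j _)    = refl

  expSum-embed : ∀ (w : PosWord n) → expSum (embed n w) ≡ ℤ.+_ (length w)
  expSum-embed []      = refl
  expSum-embed (i ∷ w) = cong (λ e → 1ℤ ℤ.+ e) (expSum-embed w)

  length-resp : ∀ {u v : PosWord n} → embed n u ≈[ n ] embed n v → length u ≡ length v
  length-resp {u} {v} p =
    ℤ.+-injective (trans (sym (expSum-embed u)) (trans (expSum-resp p) (expSum-embed v)))

-- Simple words under right multiplication by a generator

module SimpleExtensions (n : ℕ) where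

  open BraidInvariants n

  -- If w x_i represents a simple braid, then x_i is not a letter of w:
  -- otherwise the letters of the simple representative w' would all lie in w,
  -- forcing |w'| ≤ |w| < |w x_i| = |w'|.
  extension-letter-new : ∀ (w w' : PosWord n) {i} → SimpleWord n w' →
                         embed n (w ++ i ∷ []) ≈[ n ] embed n w' → i ∉ w
  extension-letter-new w w' {i} uw' eq i∈w =
    n≮n (length w) (subst (_≤ length w) longer (pigeonhole _≟ᶠ_ uw' w'⊆w))
    where
    longer : length w' ≡ suc (length w)
    longer = trans (sym (length-resp eq)) (trans (length-++ w) (+-comm (length w) 1))

    w'⊆w : ∀ {j} → j ∈ w' → j ∈ w
    w'⊆w j∈w' with ∈-++⁻ w (letters-determined uw' (λ x → sym (ρ-resp eq x)) j∈w')
    ... | inj₁ j∈w        = j∈w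
    ... | inj₂ (here refl) = i∈w

  extension-letter-unique : ∀ (w : PosWord n) {j j'} →
                            embed n (w ++ j ∷ []) ≈[ n ] embed n (w ++ j' ∷ []) → j ≡ j'
  extension-letter-unique w eq = last-letter-determined w (ρ-resp eq)

  simple-length : ∀ {w : PosWord n} → SimpleWord n w → length w ≤ pred n
  simple-length {w} uw =
    subst (length w ≤_) (length-tabulate (λ i → i)) (pigeonhole _≟ᶠ_ uw (λ _ → ∈-allFin _))

-- The edges of Γ(SB_n), enumerated by free moves

module EdgeEnumeration (n : ℕ) (L : List (PosWord n)) (sys : IsSimpleRepSystem n L) where

  open BraidInvariants n
  open SimpleExtensions n
  open DecMembership (_≟ᶠ_ {pred n}) using (_∈?_)

  N : ℕ
  N = length L

  word : Fin N → PosWord n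
  word = lookup L

  simple : ∀ a → SimpleWord n (word a)
  simple = proj₁ sys

  simple∈ : ∀ {w} → w ∈ L → SimpleWord n w
  simple∈ w∈L = subst Unique (sym (lookup-index w∈L)) (simple (Any.index w∈L))

  Step : Fin N → Gen n → Fin N → Set
  Step a j r = embed n (word a ++ j ∷ []) ≈[ n ] embed n (word r)

  -- A free move leads to a simple word, hence to some representative.
  successor : ∀ a j → j ∉ word a → Σ (Fin N) (Step a j)
  successor a j j∉w = proj₂ (proj₂ sys) _ (word a ++ j ∷ [] , appended-simple , ≈-refl)
    where
    appended-simple : SimpleWord n (word a ++ j ∷ [])
    appended-simple = Unique.++⁺ (simple a) ([] ∷ []) λ { (j∈w , here refl) → j∉w j∈w }

  step-length : ∀ {a j r} → Step a j r → length (word r) ≡ suc (length (word a))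
  step-length {a} s = trans (sym (length-resp s)) (trans (length-++ (word a)) (+-comm (length (word a)) 1))

  step-functional : ∀ {a j r r'} → Step a j r → Step a j r' → r ≡ r'
  step-functional s s' = proj₁ (proj₂ sys) _ _ (≈-trans (≈-sym s) s')

  -- Steps go up in length, so no two steps are opposite.
  no-back-step : ∀ {a b j j'} → Step a j b → Step b j' a → ⊥
  no-back-step s s' = <-asym (≤-reflexive (sym (step-length s))) (≤-reflexive (sym (step-length s')))

  Move : Set
  Move = Fin N × Gen n

  free? : Decidable (λ (m : Move) → proj₂ m ∉ word (proj₁ m))
  free? (a , j) = ¬? (j ∈? word a)

  moves : List Move
  moves = filter free? (cartesianProduct (allFin N) (allFin (pred n)))

  free-move : ∀ {a j} → (a , j) ∈ moves → j ∉ word a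
  free-move m∈ = proj₂ (∈-filter⁻ free? {xs = cartesianProduct (allFin N) (allFin (pred n))} m∈)

  move∈ : ∀ a j → j ∉ word a → (a , j) ∈ moves
  move∈ a j j∉w = ∈-filter⁺ free? (∈-cartesianProduct⁺ (∈-allFin a) (∈-allFin j)) j∉w

  -- The edge produced by a move; moves that are not free never occur in
  -- `moves`, and are sent to a dummy pair.
  edgeOf : Move → Fin N × Fin N
  edgeOf (a , j) with j ∈? word a
  ... | yes _   = a , a
  ... | no  j∉w = sortPair a (proj₁ (successor a j j∉w))

  edgeOf-step : ∀ {a j r} → j ∉ word a → Step a j r → edgeOf (a , j) ≡ sortPair a r
  edgeOf-step {a} {j} j∉w s with j ∈? word a
  ... | yes j∈w  = ⊥-elim (j∉w j∈w)
  ... | no  j∉w' = cong (sortPair a) (step-functional (proj₂ (successor a j j∉w')) s)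

  -- Equal sorted pairs come from the same move: either the two steps start
  -- at the same word and right cancellation identifies the letters, or they
  -- would be opposite steps.
  edgeOf-injective : ∀ {x y} → x ∈ moves → y ∈ moves → edgeOf x ≡ edgeOf y → x ≡ y
  edgeOf-injective {c , j} {c' , j'} x∈ y∈ same
    with successor c j (free-move x∈) | successor c' j' (free-move y∈)
  ... | r , s | r' , s'
    with sortPair-injective (trans (sym (edgeOf-step (free-move x∈) s)) (trans same (edgeOf-step (free-move y∈) s')))
  ... | inj₁ (refl , refl) = cong (c ,_) (extension-letter-unique (word c) (≈-trans s (≈-sym s')))
  ... | inj₂ (refl , refl) = ⊥-elim (no-back-step s s')

  edges : List (Fin N × Fin N)
  edges = map edgeOf moves

  edges-unique : Unique edges
  edges-unique = unique-map-local edgeOf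
    (Unique.filter⁺ free? (Unique.cartesianProduct⁺ (Unique.allFin⁺ N) (Unique.allFin⁺ (pred n))))
    edgeOf-injective

  IsEdge : Fin N × Fin N → Set
  IsEdge (a , b) = toℕ a < toℕ b × Adjacent n L a b

  step-edge : ∀ {c j r} → Step c j r → IsEdge (sortPair c r)
  step-edge {c} {j} {r} s with sortPair-cases c r (λ { refl → no-back-step s s })
  ... | inj₁ (c<r , sorted) rewrite sorted = c<r , j , inj₁ s
  ... | inj₂ (r<c , sorted) rewrite sorted = r<c , j , inj₂ s

  edges-sound : ∀ {e} → e ∈ edges → IsEdge e
  edges-sound e∈ with ∈-map⁻ edgeOf e∈
  ... | (c , j) , m∈ , refl with successor c j (free-move m∈)
  ...   | r , s = subst IsEdge (sym (edgeOf-step (free-move m∈) s)) (step-edge s)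

  edges-complete : ∀ {a b} → IsEdge (a , b) → (a , b) ∈ edges
  edges-complete {a} {b} (a<b , i , inj₁ s) =
    subst (_∈ edges) (trans (edgeOf-step i∉w s) (sortPair-< a<b)) (∈-map⁺ edgeOf (move∈ a i i∉w))
    where i∉w = extension-letter-new (word a) (word b) (simple b) s
  edges-complete {a} {b} (a<b , i , inj₂ s) =
    subst (_∈ edges) (trans (edgeOf-step i∉w s) (sortPair-> a<b)) (∈-map⁺ edgeOf (move∈ b i i∉w))
    where i∉w = extension-letter-new (word b) (word a) (simple a) s

  edges-length : length edges ≡ sum (map (λ w → pred n ∸ length w) L)
  edges-length = begin
    length edges                                            ≡⟨ length-map edgeOf moves ⟩
    length moves                                            ≡⟨ length-filter-× free? (allFin N) (allFin (pred n)) ⟩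
    sum (map (λ a → length (missing (word a))) (allFin N))  ≡⟨ cong sum (map-cong (λ a → missing-length (simple a)) (allFin N)) ⟩
    sum (map (λ a → pred n ∸ length (word a)) (allFin N))   ≡⟨ cong sum (map-tabulate (λ a → a) (λ a → pred n ∸ length (word a))) ⟩
    sum (tabulate (λ a → pred n ∸ length (word a)))         ≡⟨ cong sum (sym (map-tabulate word (λ w → pred n ∸ length w))) ⟩
    sum (map (λ w → pred n ∸ length w) (tabulate word))     ≡⟨ cong (sum ∘ map (λ w → pred n ∸ length w)) (tabulate-lookup L) ⟩
    sum (map (λ w → pred n ∸ length w) L)                   ∎

-- Proposition 6.2.  The hypothesis 2 ≤ n is only needed to exclude n = 0,
-- where no simple word has length below n.

proposition6p2 : (n : ℕ) → 2 ≤ n → (L : List (PosWord n)) → IsSimpleRepSystem n L →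
                 ∃[ E ] (IsEdgeEnumeration n L E × length E ≡ edgeFormula n L)
proposition6p2 zero    ()
proposition6p2 (suc m) _ L sys =
  edges , (edges-unique , λ _ _ → mk⇔ edges-sound edges-complete) , edge-count
  where
  open EdgeEnumeration (suc m) L sys
  open SimpleExtensions (suc m) using (simple-length)
  open Fibres length (m ∸_) using (sum-by-fibres)

  lengths-in-range : All (λ w → length w ∈ upTo (suc m)) L
  lengths-in-range = All.tabulate λ w∈L → ∈-upTo⁺ (s≤s (simple-length (simple∈ w∈L)))

  edge-count : length edges ≡ edgeFormula (suc m) L
  edge-count = trans edges-length (sum-by-fibres L (Unique.upTo⁺ (suc m)) lengths-in-range)
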